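{- Let $A$ be an alternating sign triangle of order $n$ and let $\mathcal{S}(A)$ be the set of labels of columns of $A$ with positive column sum. Then $\mathcal{S}(A)$ is a centred Catalan set of size $n$. Conversely, for every centred Catalan set $S$ of size $n$ there exists an alternating sign triangle $A$ of order $n$ with $\mathcal{S}(A)=S$.
   Context: An alternating sign triangle (AST) of order $n$ is a configuration of $n$ centred rows, the $i$-th row from the bottom having $2i-1$ entries from $\{ -1,0,1\}$, such that in all rows and columns the nonzero entries alternate in sign, all row sums are $1$, and in every column the first nonzero entry from the top is positive. Columns are labelled $-n+1,\dots,n-1$ from left to right (row $i$ occupies columns $-i+1,\dots,i-1$). A centred Catalan set of size $n$ is an $n$-subset $S$ of $\{ -n+1,\dots,n-1\}$ with $|S\cap\{ -i,\dots,i\}|\ge i+1$ for all $0\le i\le n-1$. -}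

module Defs where

open import Data.Nat as ℕ using (ℕ; zero; suc)
open import Data.Integer as ℤ using (ℤ; +_; -[1+_]; ∣_∣)
open import Data.List using (List; []; _∷_; map; downFrom; foldr)
open import Data.Bool using (Bool; true; false; if_then_else_)
open import Data.Product using (_×_; ∃)
open import Data.Sum using (_⊎_)
open import Data.Unit using (⊤)
open import Relation.Nullary using (¬_; does)
open import Relation.Binary.PropositionalEquality using (_≡_)

range : ℤ → ℕ → List ℤ
range lo zero    = []
range lo (suc k) = lo ∷ range (lo ℤ.+ ℤ.+ 1) k

sumℤ : List ℤ → ℤ
sumℤ = foldr ℤ._+_ (+ 0)

nonzeros : List ℤ → List ℤ
nonzeros []              = []
nonzeros (+ zero ∷ xs)   = nonzeros xs
nonzeros (+ suc k ∷ xs)  = + suc k ∷ nonzeros xs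
nonzeros (-[1+ k ] ∷ xs) = -[1+ k ] ∷ nonzeros xs

-- consecutive entries have opposite signs (applied to the nonzero entries,
-- which are ±1 in our setting; x ≡ - y then means opposite sign)
AlternatingSigns : List ℤ → Set
AlternatingSigns []           = ⊤
AlternatingSigns (x ∷ [])     = ⊤
AlternatingSigns (x ∷ y ∷ xs) = (x ≡ ℤ.- y) × AlternatingSigns (y ∷ xs)

FirstNonzeroPositive : List ℤ → Set
FirstNonzeroPositive xs with nonzeros xs
... | []     = ⊤
... | x ∷ _  = x ≡ ℤ.+ 1

-- Triangle arrays: A i j is the entry in row i (counted from the bottom,
-- 1 ≤ i ≤ n) and column j (with ∣ j ∣ ≤ i - 1).
InTriangle : ℕ → ℕ → ℤ → Set
InTriangle n i j = (1 ℕ.≤ i) × (i ℕ.≤ n) × (∣ j ∣ ℕ.< i)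

rowList : (ℕ → ℤ → ℤ) → ℕ → List ℤ
rowList A zero    = []
rowList A (suc k) = map (A (suc k)) (range (ℤ.- (+ k)) (suc (2 ℕ.* k)))

-- column j, read from the top (row n) to the bottom (row 1); positions
-- outside the triangle are 0 and do not affect any condition
colList : ℕ → (ℕ → ℤ → ℤ) → ℤ → List ℤ
colList n A j = map (λ i → A i j) (map suc (downFrom n))

colSum : ℕ → (ℕ → ℤ → ℤ) → ℤ → ℤ
colSum n A j = sumℤ (colList n A j)

record IsAST (n : ℕ) (A : ℕ → ℤ → ℤ) : Set where
  field
    entries   : ∀ i j → InTriangle n i j →
                (A i j ≡ + 0) ⊎ (A i j ≡ + 1) ⊎ (A i j ≡ -[1+ 0 ])
    outside   : ∀ i j → ¬ InTriangle n i j → A i j ≡ + 0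
    rowAlt    : ∀ i → 1 ℕ.≤ i → i ℕ.≤ n → AlternatingSigns (nonzeros (rowList A i))
    rowSum    : ∀ i → 1 ℕ.≤ i → i ℕ.≤ n → sumℤ (rowList A i) ≡ + 1
    colAlt    : ∀ j → AlternatingSigns (nonzeros (colList n A j))
    colFirst  : ∀ j → FirstNonzeroPositive (colList n A j)

𝒮 : ℕ → (ℕ → ℤ → ℤ) → ℤ → Bool
𝒮 n A j = does (+ 0 ℤ.<? colSum n A j)

countIn : (ℤ → Bool) → List ℤ → ℕ
countIn S []       = 0
countIn S (x ∷ xs) = (if S x then 1 else 0) ℕ.+ countIn S xs

sym-interval : ℕ → List ℤ
sym-interval i = range (ℤ.- (+ i)) (suc (2 ℕ.* i))

record IsCentredCatalanSet (n : ℕ) (S : ℤ → Bool) : Set where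
  field
    support : ∀ j → S j ≡ true → ∣ j ∣ ℕ.< n
    size    : countIn S (sym-interval (n ℕ.∸ 1)) ≡ n
    catalan : ∀ i → i ℕ.< n → suc i ℕ.≤ countIn S (sym-interval i)

-- Read from the top, the nonzero entries of an AST column alternate starting with +1,
-- so every partial column sum from the top is 0 or 1. Hence the column sums over
-- {-i,…,i} count 𝒮(A) ∩ {-i,…,i}, and since the part of each column above row i+1 has
-- nonnegative sum, this count is at least the total of the bottom i+1 rows, which lie
-- inside those columns and each sum to 1 (for i = n-1 it is exactly n).
-- Conversely, list a centred Catalan set S in the order 0, -1, 1, -2, 2, … and put a
-- single 1 in row k+1 at the (k+1)-st element of this list; the Catalan condition is
-- exactly what makes that element fit into row k+1.
module Submission where

open import Defs
open import Data.Bool using (Bool; true; false; _∧_)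
open import Data.Bool.Properties using (T-≡)
open import Data.Empty using (⊥-elim)
open import Data.Integer as ℤ using (ℤ; +_; -[1+_]; ∣_∣)
import Data.Integer.Properties as ℤP
open import Data.List using (List; []; _∷_; _++_; map; downFrom; replicate)
import Data.List.Properties as LP
open import Data.Nat as ℕ using (ℕ; zero; suc; z≤n; s≤s; _≤_; _<_; _≤′_; ≤′-refl; ≤′-step; _<ᵇ_; _≡ᵇ_)
import Data.Nat.Properties as ℕP
open import Data.Product using (_×_; Σ; ∃; _,_)
open import Data.Sum using (_⊎_; inj₁; inj₂)
open import Data.Unit using (⊤; tt)
open import Function using (_∘_; Equivalence)
open import Relation.Nullary using (¬_; does; yes; no)
open import Relation.Nullary.Decidable using (dec-false)
open import Relation.Binary.PropositionalEquality
open import Algebra.Properties.CommutativeSemigroup ℤP.+-commutativeSemigroup using (interchange)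

bit : Bool → ℕ
bit true  = 1
bit false = 0

indicator : Bool → ℤ
indicator b = + bit b

count : {X : Set} → (X → Bool) → List X → ℕ
count P []       = 0
count P (x ∷ xs) = bit (P x) ℕ.+ count P xs

countIn≡count : ∀ S xs → countIn S xs ≡ count S xs
countIn≡count S []       = refl
countIn≡count S (x ∷ xs) with S x
... | true  = cong suc (countIn≡count S xs)
... | false = countIn≡count S xs

count-++ : {X : Set} (P : X → Bool) (xs ys : List X) →
           count P (xs ++ ys) ≡ count P xs ℕ.+ count P ys
count-++ P []       ys = refl
count-++ P (x ∷ xs) ys =
  trans (cong (bit (P x) ℕ.+_) (count-++ P xs ys)) (sym (ℕP.+-assoc (bit (P x)) _ _))

count-false : {X : Set} (xs : List X) → count (λ _ → false) xs ≡ 0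
count-false []       = refl
count-false (x ∷ xs) = count-false xs

sumℤ-++ : ∀ xs ys → sumℤ (xs ++ ys) ≡ sumℤ xs ℤ.+ sumℤ ys
sumℤ-++ []       ys = sym (ℤP.+-identityˡ _)
sumℤ-++ (x ∷ xs) ys = trans (cong (ℤ._+_ x) (sumℤ-++ xs ys)) (sym (ℤP.+-assoc x _ _))

sumℤ-map-zero : {X : Set} {f : X → ℤ} → (∀ x → f x ≡ + 0) → ∀ xs → sumℤ (map f xs) ≡ + 0
sumℤ-map-zero f≡0 []       = refl
sumℤ-map-zero f≡0 (x ∷ xs) = cong₂ ℤ._+_ (f≡0 x) (sumℤ-map-zero f≡0 xs)

sumℤ-map-mono : {X : Set} {f g : X → ℤ} → (∀ x → f x ℤ.≤ g x) →
                ∀ xs → sumℤ (map f xs) ℤ.≤ sumℤ (map g xs)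
sumℤ-map-mono f≤g []       = ℤP.≤-refl
sumℤ-map-mono f≤g (x ∷ xs) = ℤP.+-mono-≤ (f≤g x) (sumℤ-map-mono f≤g xs)

sumℤ-map-+ : {X : Set} (f g : X → ℤ) (xs : List X) →
             sumℤ (map (λ x → f x ℤ.+ g x) xs) ≡ sumℤ (map f xs) ℤ.+ sumℤ (map g xs)
sumℤ-map-+ f g []       = refl
sumℤ-map-+ f g (x ∷ xs) =
  trans (cong (ℤ._+_ (f x ℤ.+ g x)) (sumℤ-map-+ f g xs)) (interchange (f x) (g x) _ _)

sumℤ-map-comm : {X Y : Set} (f : X → Y → ℤ) (xs : List X) (ys : List Y) →
                sumℤ (map (λ y → sumℤ (map (λ x → f x y) xs)) ys)
                  ≡ sumℤ (map (λ x → sumℤ (map (f x) ys)) xs)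
sumℤ-map-comm f []       ys = sumℤ-map-zero (λ _ → refl) ys
sumℤ-map-comm f (x ∷ xs) ys =
  trans (sumℤ-map-+ (f x) _ ys) (cong (ℤ._+_ (sumℤ (map (f x) ys))) (sumℤ-map-comm f xs ys))

sumℤ-map-indicator : {X : Set} (P : X → Bool) (xs : List X) →
                     sumℤ (map (indicator ∘ P) xs) ≡ + count P xs
sumℤ-map-indicator P []       = refl
sumℤ-map-indicator P (x ∷ xs) = cong (ℤ._+_ (indicator (P x))) (sumℤ-map-indicator P xs)

nonzeros-++ : ∀ xs ys → nonzeros (xs ++ ys) ≡ nonzeros xs ++ nonzeros ys
nonzeros-++ []              ys = refl
nonzeros-++ (+ zero ∷ xs)   ys = nonzeros-++ xs ys
nonzeros-++ (+ suc k ∷ xs)  ys = cong (+ suc k ∷_) (nonzeros-++ xs ys)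
nonzeros-++ (-[1+ k ] ∷ xs) ys = cong (-[1+ k ] ∷_) (nonzeros-++ xs ys)

sumℤ-nonzeros : ∀ xs → sumℤ (nonzeros xs) ≡ sumℤ xs
sumℤ-nonzeros []              = refl
sumℤ-nonzeros (+ zero ∷ xs)   = trans (sumℤ-nonzeros xs) (sym (ℤP.+-identityˡ _))
sumℤ-nonzeros (+ suc k ∷ xs)  = cong (ℤ._+_ (+ suc k)) (sumℤ-nonzeros xs)
sumℤ-nonzeros (-[1+ k ] ∷ xs) = cong (ℤ._+_ -[1+ k ]) (sumℤ-nonzeros xs)

nonzeros-map-indicator : {X : Set} (P : X → Bool) (xs : List X) →
                         nonzeros (map (indicator ∘ P) xs) ≡ replicate (count P xs) (+ 1)
nonzeros-map-indicator P []       = refl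
nonzeros-map-indicator P (x ∷ xs) with P x
... | true  = cong (+ 1 ∷_) (nonzeros-map-indicator P xs)
... | false = nonzeros-map-indicator P xs

AlternatesFrom : ℤ → List ℤ → Set
AlternatesFrom s []       = ⊤
AlternatesFrom s (x ∷ xs) = x ≡ s × AlternatesFrom (ℤ.- s) xs

alternatingSigns⇒alternatesFrom : ∀ x xs → AlternatingSigns (x ∷ xs) → AlternatesFrom x (x ∷ xs)
alternatingSigns⇒alternatesFrom x []       _          = refl , tt
alternatingSigns⇒alternatesFrom x (y ∷ xs) (x≡-y , alt) =
  refl , subst (λ s → AlternatesFrom s (y ∷ xs)) -x≡y (alternatingSigns⇒alternatesFrom y xs alt)
  where
  -x≡y : y ≡ ℤ.- x
  -x≡y = trans (sym (ℤP.neg-involutive y)) (cong ℤ.-_ (sym x≡-y))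

nonzerosAlternateFrom+1 : ∀ xs → AlternatingSigns (nonzeros xs) → FirstNonzeroPositive xs →
                          AlternatesFrom (+ 1) (nonzeros xs)
nonzerosAlternateFrom+1 xs alt first with nonzeros xs
... | []     = tt
... | y ∷ ys = subst (λ s → AlternatesFrom s (y ∷ ys)) first (alternatingSigns⇒alternatesFrom y ys alt)

alternatesFrom-++⁻ˡ : ∀ s xs ys → AlternatesFrom s (xs ++ ys) → AlternatesFrom s xs
alternatesFrom-++⁻ˡ s []       ys _           = tt
alternatesFrom-++⁻ˡ s (x ∷ xs) ys (x≡s , alt) = x≡s , alternatesFrom-++⁻ˡ (ℤ.- s) xs ys alt

sumℤ-alternatesFrom : ∀ s xs → AlternatesFrom s xs → sumℤ xs ≡ + 0 ⊎ sumℤ xs ≡ s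
sumℤ-alternatesFrom s []       _          = inj₁ refl
sumℤ-alternatesFrom s (x ∷ xs) (refl , alt) with sumℤ-alternatesFrom (ℤ.- s) xs alt
... | inj₁ rest≡0  = inj₂ (trans (cong (ℤ._+_ s) rest≡0) (ℤP.+-identityʳ s))
... | inj₂ rest≡-s = inj₁ (trans (cong (ℤ._+_ s) rest≡-s) (ℤP.+-inverseʳ s))

sumℤ-alternatesFrom+1-nonneg : ∀ xs → AlternatesFrom (+ 1) xs → + 0 ℤ.≤ sumℤ xs
sumℤ-alternatesFrom+1-nonneg xs alt with sumℤ xs | sumℤ-alternatesFrom (+ 1) xs alt
... | _ | inj₁ refl = ℤP.≤-refl
... | _ | inj₂ refl = ℤ.+≤+ z≤n

alternatingSigns-replicate : ∀ b x → AlternatingSigns (replicate (bit b) x)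
alternatingSigns-replicate true  x = tt
alternatingSigns-replicate false x = tt

firstNonzeroPositive-replicate : ∀ m xs → nonzeros xs ≡ replicate m (+ 1) → FirstNonzeroPositive xs
firstNonzeroPositive-replicate m xs eq with nonzeros xs
firstNonzeroPositive-replicate zero    xs refl | _ = tt
firstNonzeroPositive-replicate (suc m) xs refl | _ = refl

range-suc : ∀ lo k → range lo (suc k) ≡ range lo k ++ (lo ℤ.+ + k ∷ [])
range-suc lo zero    = cong (_∷ []) (sym (ℤP.+-identityʳ lo))
range-suc lo (suc k) = cong (lo ∷_) (trans (range-suc (lo ℤ.+ + 1) k)
  (cong (λ t → range (lo ℤ.+ + 1) k ++ (t ∷ [])) (ℤP.+-assoc lo (+ 1) (+ k))))

sym-interval-suc : ∀ i → sym-interval (suc i) ≡ -[1+ i ] ∷ (sym-interval i ++ (+ suc i ∷ []))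
sym-interval-suc i = begin
    range -[1+ i ] (suc (2 ℕ.* suc i))
  ≡⟨ cong (range -[1+ i ] ∘ suc) (ℕP.*-suc 2 i) ⟩
    -[1+ i ] ∷ range (-[1+ i ] ℤ.+ + 1) (suc (suc (2 ℕ.* i)))
  ≡⟨ cong (λ lo → -[1+ i ] ∷ range lo (suc (suc (2 ℕ.* i)))) (-[1+i]+1≡-i i) ⟩
    -[1+ i ] ∷ range (ℤ.- + i) (suc (suc (2 ℕ.* i)))
  ≡⟨ cong (-[1+ i ] ∷_) (range-suc (ℤ.- + i) (suc (2 ℕ.* i))) ⟩
    -[1+ i ] ∷ (sym-interval i ++ (ℤ.- + i ℤ.+ + suc (2 ℕ.* i) ∷ []))
  ≡⟨ cong (λ t → -[1+ i ] ∷ (sym-interval i ++ (t ∷ []))) right-end ⟩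
    -[1+ i ] ∷ (sym-interval i ++ (+ suc i ∷ [])) ∎
  where
  open ≡-Reasoning
  -[1+i]+1≡-i : ∀ i → -[1+ i ] ℤ.+ + 1 ≡ ℤ.- + i
  -[1+i]+1≡-i zero    = refl
  -[1+i]+1≡-i (suc i) = refl
  right-end : ℤ.- + i ℤ.+ + suc (2 ℕ.* i) ≡ + suc i
  right-end = begin
      ℤ.- + i ℤ.+ + suc (2 ℕ.* i)
    ≡⟨ cong (λ m → ℤ.- + i ℤ.+ + m) (trans (cong (suc ∘ (i ℕ.+_)) (ℕP.+-identityʳ i)) (sym (ℕP.+-suc i i))) ⟩
      ℤ.- + i ℤ.+ (+ i ℤ.+ + suc i)
    ≡⟨ sym (ℤP.+-assoc (ℤ.- + i) (+ i) (+ suc i)) ⟩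
      (ℤ.- + i ℤ.+ + i) ℤ.+ + suc i
    ≡⟨ cong (ℤ._+ + suc i) (ℤP.+-inverseˡ (+ i)) ⟩
      + suc i ∎

sumℤ-sym-interval-suc : (f : ℤ → ℤ) (i : ℕ) →
  sumℤ (map f (sym-interval (suc i))) ≡ f -[1+ i ] ℤ.+ (sumℤ (map f (sym-interval i)) ℤ.+ f (+ suc i))
sumℤ-sym-interval-suc f i = begin
    sumℤ (map f (sym-interval (suc i)))
  ≡⟨ cong (sumℤ ∘ map f) (sym-interval-suc i) ⟩
    f -[1+ i ] ℤ.+ sumℤ (map f (sym-interval i ++ (+ suc i ∷ [])))
  ≡⟨ cong (ℤ._+_ (f -[1+ i ])) (trans (cong sumℤ (LP.map-++ f (sym-interval i) _)) (sumℤ-++ (map f (sym-interval i)) _)) ⟩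
    f -[1+ i ] ℤ.+ (sumℤ (map f (sym-interval i)) ℤ.+ (f (+ suc i) ℤ.+ + 0))
  ≡⟨ cong (λ t → f -[1+ i ] ℤ.+ (sumℤ (map f (sym-interval i)) ℤ.+ t)) (ℤP.+-identityʳ _) ⟩
    f -[1+ i ] ℤ.+ (sumℤ (map f (sym-interval i)) ℤ.+ f (+ suc i)) ∎
  where open ≡-Reasoning

count-sym-interval-suc : (P : ℤ → Bool) (i : ℕ) →
  count P (sym-interval (suc i)) ≡ bit (P (+ suc i)) ℕ.+ (bit (P -[1+ i ]) ℕ.+ count P (sym-interval i))
count-sym-interval-suc P i = begin
    count P (sym-interval (suc i))
  ≡⟨ cong (count P) (sym-interval-suc i) ⟩
    a ℕ.+ count P (sym-interval i ++ (+ suc i ∷ []))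
  ≡⟨ cong (a ℕ.+_) (count-++ P (sym-interval i) _) ⟩
    a ℕ.+ (c ℕ.+ (b ℕ.+ 0))
  ≡⟨ cong (λ t → a ℕ.+ (c ℕ.+ t)) (ℕP.+-identityʳ b) ⟩
    a ℕ.+ (c ℕ.+ b)
  ≡⟨ sym (ℕP.+-assoc a c b) ⟩
    a ℕ.+ c ℕ.+ b
  ≡⟨ ℕP.+-comm (a ℕ.+ c) b ⟩
    b ℕ.+ (a ℕ.+ c) ∎
  where
  open ≡-Reasoning
  a = bit (P -[1+ i ])
  b = bit (P (+ suc i))
  c = count P (sym-interval i)

≡ᵇ-comm : ∀ m n → (m ≡ᵇ n) ≡ (n ≡ᵇ m)
≡ᵇ-comm zero    zero    = refl
≡ᵇ-comm zero    (suc n) = refl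
≡ᵇ-comm (suc m) zero    = refl
≡ᵇ-comm (suc m) (suc n) = ≡ᵇ-comm m n

bit-<ᵇ-suc : ∀ k c → bit (k <ᵇ suc c) ≡ bit (k ≡ᵇ c) ℕ.+ bit (k <ᵇ c)
bit-<ᵇ-suc zero    zero    = refl
bit-<ᵇ-suc zero    (suc c) = refl
bit-<ᵇ-suc (suc k) zero    = refl
bit-<ᵇ-suc (suc k) (suc c) = bit-<ᵇ-suc k c

bit-<ᵇ-+bit : ∀ a k c → bit (k <ᵇ bit a ℕ.+ c) ≡ bit (a ∧ (k ≡ᵇ c)) ℕ.+ bit (k <ᵇ c)
bit-<ᵇ-+bit true  k c = bit-<ᵇ-suc k c
bit-<ᵇ-+bit false k c = refl

<⇒<ᵇ≡true : ∀ {m n} → m < n → (m <ᵇ n) ≡ true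
<⇒<ᵇ≡true m<n = Equivalence.to T-≡ (ℕP.<⇒<ᵇ m<n)

count-≡ᵇ-downFrom : ∀ m n → count (_≡ᵇ m) (downFrom n) ≡ bit (m <ᵇ n)
count-≡ᵇ-downFrom m zero    = refl
count-≡ᵇ-downFrom m (suc n) = begin
    bit (n ≡ᵇ m) ℕ.+ count (_≡ᵇ m) (downFrom n)
  ≡⟨ cong₂ (λ b c → bit b ℕ.+ c) (≡ᵇ-comm n m) (count-≡ᵇ-downFrom m n) ⟩
    bit (m ≡ᵇ n) ℕ.+ bit (m <ᵇ n)
  ≡⟨ sym (bit-<ᵇ-suc m n) ⟩
    bit (m <ᵇ suc n) ∎
  where open ≡-Reasoning

𝒮-indicator : ∀ b → does (+ 0 ℤ.<? indicator b) ≡ b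
𝒮-indicator true  = refl
𝒮-indicator false = refl

downFrom-≤′ : ∀ {m n} → m ≤′ n → ∃ λ top → downFrom n ≡ top ++ downFrom m
downFrom-≤′ ≤′-refl          = [] , refl
downFrom-≤′ (≤′-step {n} m≤′n) with downFrom-≤′ m≤′n
... | top , eq = n ∷ top , cong (n ∷_) eq

colList-++ : ∀ {m n} (A : ℕ → ℤ → ℤ) j → m ≤ n → ∃ λ top → colList n A j ≡ top ++ colList m A j
colList-++ {m} A j m≤n with downFrom-≤′ (ℕP.≤⇒≤′ m≤n)
... | top , eq = map f (map suc top) , (begin
    map f (map suc (downFrom _))
  ≡⟨ cong (map f ∘ map suc) eq ⟩
    map f (map suc (top ++ downFrom m))
  ≡⟨ cong (map f) (LP.map-++ suc top _) ⟩
    map f (map suc top ++ map suc (downFrom m))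
  ≡⟨ LP.map-++ f (map suc top) _ ⟩
    map f (map suc top) ++ colList m A j ∎)
  where
  open ≡-Reasoning
  f = λ i → A i j

sumℤ-ones-downFrom : (g : ℕ → ℤ) (m : ℕ) → (∀ k → k < m → g (suc k) ≡ + 1) →
                     sumℤ (map g (map suc (downFrom m))) ≡ + m
sumℤ-ones-downFrom g zero    _   = refl
sumℤ-ones-downFrom g (suc m) g≡1 =
  cong₂ ℤ._+_ (g≡1 m ℕP.≤-refl) (sumℤ-ones-downFrom g m (λ k k<m → g≡1 k (ℕP.m<n⇒m<1+n k<m)))

-- colSum m A j, for m ≤ n, is the sum of column j over the bottom m rows.
module FromAST {n : ℕ} {A : ℕ → ℤ → ℤ} (ast : IsAST n A) where
  open IsAST ast

  column-alternates : ∀ j → AlternatesFrom (+ 1) (nonzeros (colList n A j))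
  column-alternates j = nonzerosAlternateFrom+1 (colList n A j) (colAlt j) (colFirst j)

  colSum≡indicator : ∀ j → colSum n A j ≡ indicator (𝒮 n A j)
  colSum≡indicator j
    with colSum n A j
       | subst (λ s → s ≡ + 0 ⊎ s ≡ + 1) (sumℤ-nonzeros (colList n A j))
               (sumℤ-alternatesFrom (+ 1) _ (column-alternates j))
  ... | _ | inj₁ refl = refl
  ... | _ | inj₂ refl = refl

  partial-colSum-≤ : ∀ {m} j → m ≤ n → colSum m A j ℤ.≤ colSum n A j
  partial-colSum-≤ {m} j m≤n with colList-++ A j m≤n
  ... | top , col≡ = begin
      colSum m A j
    ≡⟨ sym (ℤP.+-identityˡ _) ⟩
      + 0 ℤ.+ colSum m A j
    ≤⟨ ℤP.+-monoˡ-≤ (colSum m A j) top-nonneg ⟩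
      sumℤ top ℤ.+ colSum m A j
    ≡⟨ sym (trans (cong sumℤ col≡) (sumℤ-++ top _)) ⟩
      colSum n A j ∎
    where
    open ℤP.≤-Reasoning
    top-nonneg : + 0 ℤ.≤ sumℤ top
    top-nonneg = subst (+ 0 ℤ.≤_) (sumℤ-nonzeros top)
      (sumℤ-alternatesFrom+1-nonneg _ (alternatesFrom-++⁻ˡ (+ 1) (nonzeros top) _
        (subst (AlternatesFrom (+ 1)) (trans (cong nonzeros col≡) (nonzeros-++ top _))
          (column-alternates j))))

  rowSum-wide : ∀ k {i} → k ≤′ i → suc k ≤ n → sumℤ (map (A (suc k)) (sym-interval i)) ≡ + 1
  rowSum-wide k ≤′-refl             sk≤n = rowSum (suc k) (s≤s z≤n) sk≤n
  rowSum-wide k (≤′-step {i} k≤′i) sk≤n = begin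
      sumℤ (map (A (suc k)) (sym-interval (suc i)))
    ≡⟨ sumℤ-sym-interval-suc (A (suc k)) i ⟩
      A (suc k) -[1+ i ] ℤ.+ (row ℤ.+ A (suc k) (+ suc i))
    ≡⟨ cong₂ (λ a b → a ℤ.+ (row ℤ.+ b)) (beyond-row -[1+ i ] refl) (beyond-row (+ suc i) refl) ⟩
      + 0 ℤ.+ (row ℤ.+ + 0)
    ≡⟨ trans (ℤP.+-identityˡ _) (ℤP.+-identityʳ row) ⟩
      row
    ≡⟨ rowSum-wide k k≤′i sk≤n ⟩
      + 1 ∎
    where
    open ≡-Reasoning
    row = sumℤ (map (A (suc k)) (sym-interval i))
    beyond-row : ∀ j → ∣ j ∣ ≡ suc i → A (suc k) j ≡ + 0
    beyond-row j ∣j∣≡ = outside (suc k) j λ (_ , _ , ∣j∣<sk) →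
      ℕP.<⇒≱ (ℕP.≤-pred (subst (_< suc k) ∣j∣≡ ∣j∣<sk)) (ℕP.≤′⇒≤ k≤′i)

  sumℤ-partial-colSums : ∀ {m} i → m ≤ suc i → m ≤ n → sumℤ (map (colSum m A) (sym-interval i)) ≡ + m
  sumℤ-partial-colSums {m} i m≤si m≤n =
    trans (sumℤ-map-comm A (map suc (downFrom m)) (sym-interval i))
      (sumℤ-ones-downFrom (λ r → sumℤ (map (A r) (sym-interval i))) m λ k k<m →
        rowSum-wide k (ℕP.≤⇒≤′ (ℕP.≤-pred (ℕP.≤-trans k<m m≤si))) (ℕP.≤-trans k<m m≤n))

  colSum-outside : ∀ j → n ≤ ∣ j ∣ → colSum n A j ≡ + 0
  colSum-outside j n≤∣j∣ = sumℤ-map-zero (λ r → outside r j λ (_ , r≤n , ∣j∣<r) →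
    ℕP.<⇒≱ (ℕP.<-≤-trans ∣j∣<r r≤n) n≤∣j∣) (map suc (downFrom n))

  countIn-𝒮 : ∀ xs → + countIn (𝒮 n A) xs ≡ sumℤ (map (colSum n A) xs)
  countIn-𝒮 xs = begin
      + countIn (𝒮 n A) xs
    ≡⟨ cong +_ (countIn≡count (𝒮 n A) xs) ⟩
      + count (𝒮 n A) xs
    ≡⟨ sym (sumℤ-map-indicator (𝒮 n A) xs) ⟩
      sumℤ (map (indicator ∘ 𝒮 n A) xs)
    ≡⟨ cong sumℤ (LP.map-cong (sym ∘ colSum≡indicator) xs) ⟩
      sumℤ (map (colSum n A) xs) ∎
    where open ≡-Reasoning

  isCentredCatalanSet : IsCentredCatalanSet n (𝒮 n A)
  isCentredCatalanSet = record { support = support ; size = size ; catalan = catalan }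
    where
    support : ∀ j → 𝒮 n A j ≡ true → ∣ j ∣ < n
    support j j∈𝒮 with ∣ j ∣ ℕ.<? n
    ... | yes ∣j∣<n = ∣j∣<n
    ... | no  ∣j∣≮n with () ← trans (sym (colSum-outside j (ℕP.≮⇒≥ ∣j∣≮n)))
                                    (trans (colSum≡indicator j) (cong indicator j∈𝒮))

    size : countIn (𝒮 n A) (sym-interval (n ℕ.∸ 1)) ≡ n
    size = ℤP.+-injective (trans (countIn-𝒮 (sym-interval (n ℕ.∸ 1)))
             (sumℤ-partial-colSums (n ℕ.∸ 1) (ℕP.m≤n+m∸n n 1) ℕP.≤-refl))

    catalan : ∀ i → i < n → suc i ≤ countIn (𝒮 n A) (sym-interval i)
    catalan i i<n = ℤP.drop‿+≤+ (begin
        + suc i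
      ≡⟨ sym (sumℤ-partial-colSums i ℕP.≤-refl i<n) ⟩
        sumℤ (map (colSum (suc i) A) (sym-interval i))
      ≤⟨ sumℤ-map-mono (λ j → partial-colSum-≤ j i<n) (sym-interval i) ⟩
        sumℤ (map (colSum n A) (sym-interval i))
      ≡⟨ sym (countIn-𝒮 (sym-interval i)) ⟩
        + countIn (𝒮 n A) (sym-interval i) ∎)
      where open ℤP.≤-Reasoning

module ToAST {n : ℕ} {S : ℤ → Bool} (catalanSet : IsCentredCatalanSet n S) where
  open IsCentredCatalanSet catalanSet

  sizeWithin : ℕ → ℕ
  sizeWithin i = count S (sym-interval i)

  sizeWithin-suc : ∀ i → sizeWithin (suc i) ≡ bit (S (+ suc i)) ℕ.+ (bit (S -[1+ i ]) ℕ.+ sizeWithin i)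
  sizeWithin-suc = count-sym-interval-suc S

  sizeWithin-mono : ∀ {i i′} → i ≤′ i′ → sizeWithin i ≤ sizeWithin i′
  sizeWithin-mono ≤′-refl            = ℕP.≤-refl
  sizeWithin-mono {i} (≤′-step {i′} i≤′i′) = begin
      sizeWithin i                                              ≤⟨ sizeWithin-mono i≤′i′ ⟩
      sizeWithin i′                                             ≤⟨ ℕP.m≤n+m _ (bit (S -[1+ i′ ])) ⟩
      bit (S -[1+ i′ ]) ℕ.+ sizeWithin i′                       ≤⟨ ℕP.m≤n+m _ (bit (S (+ suc i′))) ⟩
      bit (S (+ suc i′)) ℕ.+ (bit (S -[1+ i′ ]) ℕ.+ sizeWithin i′) ≡⟨ sizeWithin-suc i′ ⟨
      sizeWithin (suc i′)                                       ∎
    where open ℕP.≤-Reasoning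

  sizeWithin≤n : ∀ {i} → i < n → sizeWithin i ≤ n
  sizeWithin≤n i<n = ℕP.≤-trans (sizeWithin-mono (ℕP.≤⇒≤′ (ℕP.∸-monoˡ-≤ 1 i<n)))
    (ℕP.≤-reflexive (trans (sym (countIn≡count S (sym-interval (n ℕ.∸ 1)))) size))

  i<sizeWithin : ∀ {i} → i < n → i < sizeWithin i
  i<sizeWithin {i} i<n = subst (suc i ≤_) (countIn≡count S (sym-interval i)) (catalan i i<n)

  -- The number of elements of S before j in the order 0, -1, 1, -2, 2, …
  rank : ℤ → ℕ
  rank (+ zero)  = 0
  rank -[1+ m ]  = sizeWithin m
  rank (+ suc m) = bit (S -[1+ m ]) ℕ.+ sizeWithin m

  rank<sizeWithin : ∀ j → S j ≡ true → rank j < sizeWithin ∣ j ∣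
  rank<sizeWithin (+ zero)  j∈S = subst (λ b → 0 < bit b ℕ.+ 0) (sym j∈S) ℕP.≤-refl
  rank<sizeWithin -[1+ m ]  j∈S = begin
      suc (sizeWithin m)                 ≡⟨ cong (λ b → bit b ℕ.+ sizeWithin m) (sym j∈S) ⟩
      bit (S -[1+ m ]) ℕ.+ sizeWithin m  ≤⟨ ℕP.m≤n+m _ (bit (S (+ suc m))) ⟩
      bit (S (+ suc m)) ℕ.+ (bit (S -[1+ m ]) ℕ.+ sizeWithin m) ≡⟨ sizeWithin-suc m ⟨
      sizeWithin (suc m)                 ∎
    where open ℕP.≤-Reasoning
  rank<sizeWithin (+ suc m) j∈S =
    ℕP.≤-reflexive (trans (cong (λ b → bit b ℕ.+ rank (+ suc m)) (sym j∈S)) (sym (sizeWithin-suc m)))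

  rank<n : ∀ j → S j ≡ true → rank j < n
  rank<n j j∈S = ℕP.<-≤-trans (rank<sizeWithin j j∈S) (sizeWithin≤n (support j j∈S))

  ∣∣≤rank : ∀ j → S j ≡ true → ∣ j ∣ ≤ rank j
  ∣∣≤rank (+ zero)  j∈S = z≤n
  ∣∣≤rank -[1+ m ]  j∈S = i<sizeWithin (ℕP.<-trans (ℕP.n<1+n m) (support _ j∈S))
  ∣∣≤rank (+ suc m) j∈S =
    ℕP.≤-trans (i<sizeWithin (ℕP.<-trans (ℕP.n<1+n m) (support _ j∈S))) (ℕP.m≤n+m (sizeWithin m) (bit (S -[1+ m ])))

  triangle : ℕ → ℤ → ℤ
  triangle zero    j = + 0
  triangle (suc k) j = indicator (S j ∧ (k ≡ᵇ rank j))

  row-count : ∀ k i → count (λ j → S j ∧ (k ≡ᵇ rank j)) (sym-interval i) ≡ bit (k <ᵇ sizeWithin i)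
  row-count k zero    = sym (bit-<ᵇ-+bit (S (+ 0)) k 0)
  row-count k (suc i) = begin
      count P (sym-interval (suc i))
    ≡⟨ count-sym-interval-suc P i ⟩
      bit (P (+ suc i)) ℕ.+ (bit (P -[1+ i ]) ℕ.+ count P (sym-interval i))
    ≡⟨ cong (λ c → bit (P (+ suc i)) ℕ.+ (bit (P -[1+ i ]) ℕ.+ c)) (row-count k i) ⟩
      bit (P (+ suc i)) ℕ.+ (bit (P -[1+ i ]) ℕ.+ bit (k <ᵇ sizeWithin i))
    ≡⟨ cong (bit (P (+ suc i)) ℕ.+_) (bit-<ᵇ-+bit (S -[1+ i ]) k (sizeWithin i)) ⟨
      bit (P (+ suc i)) ℕ.+ bit (k <ᵇ rank (+ suc i))
    ≡⟨ bit-<ᵇ-+bit (S (+ suc i)) k (rank (+ suc i)) ⟨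
      bit (k <ᵇ bit (S (+ suc i)) ℕ.+ rank (+ suc i))
    ≡⟨ cong (bit ∘ (k <ᵇ_)) (sizeWithin-suc i) ⟨
      bit (k <ᵇ sizeWithin (suc i)) ∎
    where
    open ≡-Reasoning
    P = λ j → S j ∧ (k ≡ᵇ rank j)

  row-nonzeros : ∀ k → k < n → nonzeros (rowList triangle (suc k)) ≡ + 1 ∷ []
  row-nonzeros k k<n = trans (nonzeros-map-indicator _ (sym-interval k))
    (cong (λ m → replicate m (+ 1)) (trans (row-count k k) (cong bit (<⇒<ᵇ≡true (i<sizeWithin k<n)))))

  column-count : ∀ j → count (λ k → S j ∧ (k ≡ᵇ rank j)) (downFrom n) ≡ bit (S j)
  column-count j with S j in j∈S
  ... | false = count-false (downFrom n)
  ... | true  = trans (count-≡ᵇ-downFrom (rank j) n) (cong bit (<⇒<ᵇ≡true (rank<n j j∈S)))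

  column≡ : ∀ j → colList n triangle j ≡ map (indicator ∘ λ k → S j ∧ (k ≡ᵇ rank j)) (downFrom n)
  column≡ j = sym (LP.map-∘ (downFrom n))

  column-nonzeros : ∀ j → nonzeros (colList n triangle j) ≡ replicate (bit (S j)) (+ 1)
  column-nonzeros j = trans (cong nonzeros (column≡ j))
    (trans (nonzeros-map-indicator _ (downFrom n)) (cong (λ m → replicate m (+ 1)) (column-count j)))

  colSum-triangle : ∀ j → colSum n triangle j ≡ indicator (S j)
  colSum-triangle j = trans (cong sumℤ (column≡ j))
    (trans (sumℤ-map-indicator _ (downFrom n)) (cong +_ (column-count j)))

  𝒮-triangle : ∀ j → 𝒮 n triangle j ≡ S j
  𝒮-triangle j = trans (cong (λ s → does (+ 0 ℤ.<? s)) (colSum-triangle j)) (𝒮-indicator (S j))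

  isAST : IsAST n triangle
  isAST = record
    { entries  = λ i j _ → entries i j
    ; outside  = outside
    ; rowAlt   = λ { (suc k) _ sk≤n → subst AlternatingSigns (sym (row-nonzeros k sk≤n)) tt }
    ; rowSum   = λ { (suc k) _ sk≤n → trans (sym (sumℤ-nonzeros (rowList triangle (suc k)))) (cong sumℤ (row-nonzeros k sk≤n)) }
    ; colAlt   = λ j → subst AlternatingSigns (sym (column-nonzeros j)) (alternatingSigns-replicate (S j) (+ 1))
    ; colFirst = λ j → firstNonzeroPositive-replicate (bit (S j)) (colList n triangle j) (column-nonzeros j)
    }
    where
    entries : ∀ i j → (triangle i j ≡ + 0) ⊎ (triangle i j ≡ + 1) ⊎ (triangle i j ≡ -[1+ 0 ])
    entries zero    j = inj₁ refl
    entries (suc k) j with S j ∧ (k ≡ᵇ rank j)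
    ... | true  = inj₂ (inj₁ refl)
    ... | false = inj₁ refl

    outside : ∀ i j → ¬ InTriangle n i j → triangle i j ≡ + 0
    outside zero    j _ = refl
    outside (suc k) j ∉ with S j in j∈S | k ℕ.≟ rank j
    ... | false | _          = refl
    ... | true  | no k≢rank = cong indicator (dec-false (k ℕ.≟ rank j) k≢rank)
    ... | true  | yes refl  = ⊥-elim (∉ (s≤s z≤n , rank<n j j∈S , s≤s (∣∣≤rank j j∈S)))

proposition2p4 : (n : ℕ) →
    ((A : ℕ → ℤ → ℤ) → IsAST n A → IsCentredCatalanSet n (𝒮 n A))
    × ((S : ℤ → Bool) → IsCentredCatalanSet n S →
        Σ (ℕ → ℤ → ℤ) (λ A → IsAST n A × (∀ j → 𝒮 n A j ≡ S j)))
proposition2p4 n =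
  (λ A ast → FromAST.isCentredCatalanSet ast) ,
  (λ S catalanSet → ToAST.triangle catalanSet , ToAST.isAST catalanSet , ToAST.𝒮-triangle catalanSet)
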